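{- If $G$ is a balanced, $p$-critical interval graph, then $G$ has exactly one basepoint.
   Context: A finite simple graph $G=(V,E)$ is an interval graph if there is an assignment (representation) $\alpha: v\mapsto I_v$ of vertices to intervals of the real line such that $vw\in E$ iff $I_v\cap I_w\neq\emptyset$. For a representation $\alpha$ and vertex $z$, $\mathrm{imp}_\alpha(z)$ is the number of intervals $I_w$, $w\ne z$, contained in $I_z$; $\mathrm{imp}(\alpha)=\max_z\mathrm{imp}_\alpha(z)$; the impropriety is $\mathrm{imp}(G)=\min_\alpha\mathrm{imp}(\alpha)$. A local component at $z$ is a connected component of $G\setminus\{z\}$; it is exterior if it contains a vertex not adjacent to $z$. If $z$ has $n$ local components, $\mathrm{wt}(z)$ is the sum of the $n-2$ smallest orders among the non-exterior local components at $z$ ($0$ if $n\le2$), and $\mathrm{wt}(G)=\max_z\mathrm{wt}(z)$. $G$ is balanced if $\mathrm{wt}(G)=\mathrm{imp}(G)$; in that case a basepoint of $G$ is a vertex $z$ with $\mathrm{wt}(z)=\mathrm{imp}(G)$. For an integer $p>0$, an interval graph $G$ is $p$-critical if $\mathrm{imp}(G)=p$ and every proper induced subgraph of $G$ has impropriety strictly less than $p$. -}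

module Defs where

open import Data.Nat using (ℕ; zero; suc; _≤_; _<_; _⊔_; _∸_; _≤?_)
open import Data.Nat.Properties using (≤-decTotalOrder)
open import Data.Bool using (Bool; true; false; _∧_; _∨_; not; T?)
open import Data.Bool.ListAction using (any; all)
open import Data.Nat.ListAction using (sum)
open import Data.Fin using (Fin; toℕ; _≟_)
open import Data.List using (List; []; _∷_; map; filter; length; foldr; take)
open import Data.List.Base using (allFin)
open import Data.Product using (Σ; _×_; _,_; ∃)
open import Relation.Nullary using (¬_; Dec; yes; no)
open import Relation.Nullary.Decidable using (⌊_⌋; ¬?; _×-dec_)
open import Relation.Binary.PropositionalEquality using (_≡_; _≢_; refl)
open import Function.Bundles using (_⇔_)
open import Function.Definitions using (Injective)
open import Data.List.Sort.InsertionSort ≤-decTotalOrder using (sort)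

record Graph (n : ℕ) : Set where
  field
    adj    : Fin n → Fin n → Bool
    sym    : ∀ u v → adj u v ≡ adj v u
    irrefl : ∀ v → adj v v ≡ false
open Graph public

-- the subgraph induced by the image of f : Fin m → Fin n
-- (a proper induced subgraph when f is injective and m < n)
induced : ∀ {n m} → Graph n → (Fin m → Fin n) → Graph m
induced G f = record
  { adj    = λ i j → adj G (f i) (f j)
  ; sym    = λ i j → sym G (f i) (f j)
  ; irrefl = λ i → irrefl G (f i)
  }

-- Endpoints are taken in ℕ:
-- intersection and containment of finitely many closed intervals only
-- depend on the relative order of their endpoints, so every real
-- representation can be replaced by one with natural endpoints having
-- the same intersection and containment pattern.

record Interval : Set where
  constructor [_,_∣_]
  field
    lo   : ℕ
    hi   : ℕ
    lo≤hi : lo ≤ hi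
open Interval public

Meets : Interval → Interval → Set
Meets I J = (lo I ≤ hi J) × (lo J ≤ hi I)

_⊆ᴵ_ : Interval → Interval → Set
I ⊆ᴵ J = (lo J ≤ lo I) × (hi I ≤ hi J)

_⊆ᴵ?_ : (I J : Interval) → Dec (I ⊆ᴵ J)
I ⊆ᴵ? J = (lo J ≤? lo I) ×-dec (hi I ≤? hi J)

record Representation {n : ℕ} (G : Graph n) : Set where
  field
    I       : Fin n → Interval
    correct : ∀ v w → v ≢ w → (adj G v w ≡ true ⇔ Meets (I v) (I w))
open Representation public

IsIntervalGraph : ∀ {n} → Graph n → Set
IsIntervalGraph G = Representation G

maxList : List ℕ → ℕ
maxList = foldr _⊔_ 0

impAt : ∀ {n} {G : Graph n} → Representation G → Fin n → ℕ
impAt {n} α z =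
  length (filter (λ w → ¬? (w ≟ z) ×-dec (I α w ⊆ᴵ? I α z)) (allFin n))

impRep : ∀ {n} {G : Graph n} → Representation G → ℕ
impRep {n} α = maxList (map (impAt α) (allFin n))

Imp : ∀ {n} → Graph n → ℕ → Set
Imp G p = Σ (Representation G) (λ α → impRep α ≡ p)
        × (∀ (α : Representation G) → p ≤ impRep α)

Critical : ∀ {n} → Graph n → ℕ → Set
Critical {n} G p =
    (0 < p)
  × Imp G p
  × (∀ (m : ℕ) (f : Fin m → Fin n) → Injective _≡_ _≡_ f → m < n →
       ∀ q → Imp (induced G f) q → q < p)

-- Local components at z (connected components of G ∖ {z})

module _ {n : ℕ} (G : Graph n) (z : Fin n) where

  neqZ : Fin n → Bool
  neqZ v = not ⌊ v ≟ z ⌋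

  step : (Fin n → Bool) → (Fin n → Bool)
  step S v = S v ∨ (neqZ v ∧ any (λ u → S u ∧ adj G u v) (allFin n))

  iter : ℕ → (Fin n → Bool) → (Fin n → Bool)
  iter zero    S = S
  iter (suc k) S = step (iter k S)

  -- conn u v : v is reachable from u by a path in G ∖ {z}
  -- (paths have fewer than n edges, so n growth steps suffice)
  conn : Fin n → Fin n → Bool
  conn u v = neqZ u ∧ neqZ v ∧ iter n (λ w → ⌊ w ≟ u ⌋) v

  comp : Fin n → List (Fin n)
  comp u = filter (λ v → T? (conn u v)) (allFin n)

  -- u represents its local component: u ≠ z and u is its least element
  isRep : Fin n → Bool
  isRep u = neqZ u ∧ all (λ v → ⌊ toℕ u ≤? toℕ v ⌋) (comp u)

  reps : List (Fin n)
  reps = filter (λ u → T? (isRep u)) (allFin n)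

  numComps : ℕ
  numComps = length reps

  isExterior : Fin n → Bool
  isExterior u = any (λ v → not (adj G z v)) (comp u)

  nonExtOrders : List ℕ
  nonExtOrders = map (λ u → length (comp u))
                     (filter (λ u → T? (not (isExterior u))) reps)

  -- wt(z): sum of the (numComps − 2) smallest non-exterior orders
  -- (0 when numComps ≤ 2, since then numComps ∸ 2 = 0)
  wt : ℕ
  wt = sum (take (numComps ∸ 2) (sort nonExtOrders))

wtG : ∀ {n} → Graph n → ℕ
wtG {n} G = maxList (map (wt G) (allFin n))

Balanced : ∀ {n} → Graph n → Set
Balanced G = Σ ℕ (λ p → Imp G p × wtG G ≡ p)

IsBasepoint : ∀ {n} → Graph n → ℕ → Fin n → Set
IsBasepoint G p z = wt G z ≡ p

-- A p-critical graph is connected: representations of the two sides of a cut, placed side by side,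
-- would represent G with impropriety < p.  So every local component at a vertex contains a neighbour
-- of it.  Let c be a basepoint and x ≠ c a vertex of positive weight, i.e. with at least three local
-- components.  Two of them avoid c, and the neighbours of x in them are not adjacent to c; so the
-- local component of x at c is exterior and contains an anchor, an edge x₁x₂ with x₁ adjacent to c
-- and x₂ not.  Let H consist of c, the non-exterior local components at c, and the anchor of the
-- component of x, plus that of a second exterior component if there is one.  H misses a vertex of
-- the component of x, so by criticality it has a representation of impropriety < p.  There the
-- interval of each anchor vertex x₁ contains an endpoint of I_c, different anchors different ones.
-- A non-exterior component not represented inside I_c also contains an endpoint of I_c, and no two
-- components share one.  Hence at least min(numComps(c) − 2, #non-exterior) components lie inside
-- I_c, and their orders, counted by imp at c, sum to at least wt(c) = p: a contradiction.
{-# OPTIONS --safe #-}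
module Submission where

open import Defs hiding (sym)
open import Data.Bool using (Bool; true; false; _∧_; _∨_; not; T; T?)
open import Data.Bool.ListAction using (any; all)
open import Data.Bool.Properties using (T-∨) renaming (_≟_ to _≟ᵇ_)
open import Data.Empty using (⊥; ⊥-elim)
open import Data.Fin using (Fin; toℕ; _≟_) renaming (zero to fzero; suc to fsuc)
open import Data.Fin.Properties using (toℕ-injective; any?; all?; ¬∀⟶∃¬)
open import Data.List using (List; []; _∷_; map; filter; length; take; lookup)
open import Data.List.Base using (allFin)
open import Data.List.Membership.Propositional using (_∈_; lose)
open import Data.List.Membership.Propositional.Properties
  using (∈-allFin; ∈-filter⁺; ∈-filter⁻; ∈-lookup; ∈-map⁺; ∈-map⁻)
open import Data.List.Properties
  using (length-filter; filter-some; filter-none; filter-all; filter-accept; filter-notAll;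
         length-map; length-tabulate; map-tabulate; tabulate-lookup)
open import Data.List.Relation.Binary.Permutation.Propositional.Properties using (↭-length)
open import Data.List.Relation.Binary.Sublist.Propositional using (⊆-refl)
open import Data.List.Relation.Binary.Sublist.Propositional.Properties using (filter⁺; length-mono-≤)
open import Data.List.Relation.Unary.All using (All; []; _∷_)
import Data.List.Relation.Unary.All as All
open import Data.List.Relation.Unary.AllPairs using (AllPairs; []; _∷_)
open import Data.List.Relation.Unary.Any using (here; there; index)
open import Data.List.Relation.Unary.Any.Properties using (lookup-index)
open import Data.List.Relation.Unary.Linked.Properties using (Linked⇒AllPairs)
open import Data.List.Relation.Unary.Unique.Propositional using (Unique)
import Data.List.Relation.Unary.Unique.Propositional.Properties as Unique
open import Data.Nat using (ℕ; zero; suc; _+_; _∸_; _≤_; _<_; _⊔_; z≤n; s≤s; _≤?_; _≤ᵇ_)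
open import Data.Nat.Induction using (<-rec)
open import Data.Nat.ListAction using (sum)
open import Data.Nat.Properties hiding (_≟_)
open import Algebra.Properties.CommutativeSemigroup +-commutativeSemigroup using (x∙yz≈y∙xz)
open import Data.List.Sort.InsertionSort ≤-decTotalOrder using (sort)
open import Data.List.Sort.InsertionSort.Base ≤-decTotalOrder using (insert)
open import Data.List.Sort.InsertionSort.Properties ≤-decTotalOrder using (sort-↗; sort-↭)
open import Data.Product using (Σ; ∃; _×_; _,_; proj₁; proj₂)
open import Data.Sum using (_⊎_; inj₁; inj₂; [_,_])
open import Data.Unit using (⊤; tt)
open import Function using (_∘_)
open import Function.Bundles using (_⇔_; mk⇔; Equivalence)
open import Function.Definitions using (Injective)
open import Relation.Binary.Definitions using (DecidableEquality)
open import Relation.Binary.PropositionalEquality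
  using (_≡_; _≢_; refl; sym; trans; cong; cong₂; subst; subst₂; module ≡-Reasoning)
open import Relation.Nullary using (¬_; Dec; yes; no; contradiction)
open import Relation.Nullary.Decidable using (⌊_⌋; ¬?; _×-dec_; _→-dec_; toSum)
open import Relation.Unary using (Pred; Decidable; _⊆_)

≡true⇒≢false : ∀ {b} → b ≡ true → b ≢ false
≡true⇒≢false refl ()

∧-true⁺ : ∀ {a b} → a ≡ true → b ≡ true → a ∧ b ≡ true
∧-true⁺ refl refl = refl

∧-true⁻ : ∀ a {b} → a ∧ b ≡ true → a ≡ true × b ≡ true
∧-true⁻ true {true} _ = refl , refl

∨-true⁺ˡ : ∀ {a} b → a ≡ true → a ∨ b ≡ true
∨-true⁺ˡ _ refl = refl

∨-true⁺ʳ : ∀ a {b} → b ≡ true → a ∨ b ≡ true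
∨-true⁺ʳ true  _ = refl
∨-true⁺ʳ false e = e

∨-true⁻ : ∀ a {b} → a ∨ b ≡ true → a ≡ true ⊎ b ≡ true
∨-true⁻ true  _ = inj₁ refl
∨-true⁻ false e = inj₂ e

not-true⁺ : ∀ {a} → a ≡ false → not a ≡ true
not-true⁺ refl = refl

not-true⁻ : ∀ a → not a ≡ true → a ≡ false
not-true⁻ false _ = refl

not-false⁺ : ∀ {a} → a ≡ true → not a ≡ false
not-false⁺ refl = refl

≡true⇒T : ∀ {b} → b ≡ true → T b
≡true⇒T refl = _

T⇒≡true : ∀ {b} → T b → b ≡ true
T⇒≡true {true} _ = refl

dec-true⁺ : ∀ {p} {P : Set p} (P? : Dec P) → P → ⌊ P? ⌋ ≡ true
dec-true⁺ (yes _) _  = refl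
dec-true⁺ (no ¬x) x = contradiction x ¬x

dec-true⁻ : ∀ {p} {P : Set p} (P? : Dec P) → ⌊ P? ⌋ ≡ true → P
dec-true⁻ (yes x) _ = x

dec-false⁺ : ∀ {p} {P : Set p} (P? : Dec P) → ¬ P → ⌊ P? ⌋ ≡ false
dec-false⁺ (yes x) ¬x = contradiction x ¬x
dec-false⁺ (no _)  _  = refl

dec-false⁻ : ∀ {p} {P : Set p} (P? : Dec P) → ⌊ P? ⌋ ≡ false → ¬ P
dec-false⁻ (no ¬x) _ = ¬x

module _ {a} {A : Set a} (p : A → Bool) where

  any-true⁺ : ∀ {x xs} → x ∈ xs → p x ≡ true → any p xs ≡ true
  any-true⁺ {xs = y ∷ _} (here refl) px = ∨-true⁺ˡ _ px
  any-true⁺ {xs = y ∷ _} (there x∈) px = ∨-true⁺ʳ (p y) (any-true⁺ x∈ px)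

  any-true⁻ : ∀ xs → any p xs ≡ true → ∃ λ x → x ∈ xs × p x ≡ true
  any-true⁻ (y ∷ xs) e with ∨-true⁻ (p y) e
  ... | inj₁ py = y , here refl , py
  ... | inj₂ e′ = let x , x∈ , px = any-true⁻ xs e′ in x , there x∈ , px

  all-true⁻ : ∀ {x xs} → all p xs ≡ true → x ∈ xs → p x ≡ true
  all-true⁻ {xs = y ∷ _} e (here refl) = proj₁ (∧-true⁻ (p y) e)
  all-true⁻ {xs = y ∷ _} e (there x∈) = all-true⁻ (proj₂ (∧-true⁻ (p y) e)) x∈

module _ {a} {A : Set a} where

  length-filter-mono : ∀ {p q} {P : Pred A p} {Q : Pred A q} (P? : Decidable P) (Q? : Decidable Q) →
    P ⊆ Q → ∀ xs → length (filter P? xs) ≤ length (filter Q? xs)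
  length-filter-mono P? Q? P⊆Q xs = length-mono-≤ (filter⁺ P? Q? (λ { refl → P⊆Q }) (⊆-refl {x = xs}))

  length-filter-< : ∀ {p q} {P : Pred A p} {Q : Pred A q} (P? : Decidable P) (Q? : Decidable Q) →
    P ⊆ Q → ∀ {y xs} → y ∈ xs → Q y → ¬ P y → length (filter P? xs) < length (filter Q? xs)
  length-filter-< P? Q? P⊆Q {xs = x ∷ xs} (here refl) qx ¬px with P? x | Q? x
  ... | yes px | _      = contradiction px ¬px
  ... | no _   | yes _  = s≤s (length-filter-mono P? Q? P⊆Q xs)
  ... | no _   | no ¬qx = contradiction qx ¬qx
  length-filter-< P? Q? P⊆Q {xs = x ∷ xs} (there y∈) qy ¬py
    with ih ← length-filter-< P? Q? P⊆Q y∈ qy ¬py | P? x | Q? x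
  ... | yes px | yes _  = s≤s ih
  ... | yes px | no ¬qx = contradiction (P⊆Q px) ¬qx
  ... | no _   | yes _  = m≤n⇒m≤1+n ih
  ... | no _   | no _   = ih

  length-filter-≤1 : ∀ {p} {P : Pred A p} (P? : Decidable P) → ∀ {xs} → Unique xs →
    (∀ {x y} → x ∈ xs → y ∈ xs → x ≢ y → P x → P y → ⊥) → length (filter P? xs) ≤ 1
  length-filter-≤1 P? {[]}     _              _ = z≤n
  length-filter-≤1 P? {x ∷ xs} (x∉xs ∷ uniq) h with P? x
  ... | no _   = length-filter-≤1 P? uniq (λ y∈ z∈ → h (there y∈) (there z∈))
  ... | yes px = s≤s (≤-reflexive (cong length (filter-none P? (All.tabulate
                   (λ y∈ py → h (here refl) (there y∈) (All.lookup x∉xs y∈) px py)))))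

  length-filter-⊎ : ∀ {p q r} {P : Pred A p} {Q : Pred A q} {R : Pred A r}
    (P? : Decidable P) (Q? : Decidable Q) (R? : Decidable R) →
    (∀ {x} → R x → P x ⊎ Q x) → P ⊆ R → Q ⊆ R → (∀ {x} → P x → Q x → ⊥) →
    ∀ xs → length (filter R? xs) ≡ length (filter P? xs) + length (filter Q? xs)
  length-filter-⊎ P? Q? R? R⊆P∪Q P⊆R Q⊆R disjoint [] = refl
  length-filter-⊎ P? Q? R? R⊆P∪Q P⊆R Q⊆R disjoint (x ∷ xs)
    with ih ← length-filter-⊎ P? Q? R? R⊆P∪Q P⊆R Q⊆R disjoint xs | R? x | P? x | Q? x
  ... | _      | yes px | yes qx = ⊥-elim (disjoint px qx)
  ... | yes _  | yes _  | no _   = cong suc ih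
  ... | yes _  | no _   | yes _  = trans (cong suc ih) (sym (+-suc _ _))
  ... | no _   | no _   | no _   = ih
  ... | yes rx | no ¬px | no ¬qx = ⊥-elim ([ ¬px , ¬qx ] (R⊆P∪Q rx))
  ... | no ¬rx | yes px | _      = contradiction (P⊆R px) ¬rx
  ... | no ¬rx | no _   | yes qx = contradiction (Q⊆R qx) ¬rx

  length-filter-partition : ∀ {p q} {P : Pred A p} {Q : Pred A q} (P? : Decidable P) (Q? : Decidable Q) →
    (∀ x → P x ⊎ Q x) → (∀ {x} → P x → Q x → ⊥) →
    ∀ xs → length (filter P? xs) + length (filter Q? xs) ≡ length xs
  length-filter-partition P? Q? cover disjoint xs = begin
    length (filter P? xs) + length (filter Q? xs)  ≡⟨ length-filter-⊎ P? Q? U? (λ {x} _ → cover x) _ _ disjoint xs ⟨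
    length (filter U? xs)                          ≡⟨ cong length (filter-all U? (All.universal _ xs)) ⟩
    length xs                                      ∎
    where
    open ≡-Reasoning
    U? : Decidable {A = A} (λ _ → ⊤)
    U? _ = yes tt

  length-filter-∷ : ∀ {p} {P : Pred A p} (P? : Decidable P) x xs →
    length (filter P? xs) ≤ length (filter P? (x ∷ xs))
  length-filter-∷ P? x xs with P? x
  ... | yes _ = n≤1+n _
  ... | no _  = ≤-refl

  length-filter-∪ : ∀ {p q r} {P : Pred A p} {Q : Pred A q} {R : Pred A r}
    (P? : Decidable P) (Q? : Decidable Q) (R? : Decidable R) →
    ∀ xs → (∀ {x} → x ∈ xs → R x → P x ⊎ Q x) →
    length (filter R? xs) ≤ length (filter P? xs) + length (filter Q? xs)
  length-filter-∪ P? Q? R? [] _ = z≤n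
  length-filter-∪ P? Q? R? (x ∷ xs) R⊆P∪Q
    with ih ← length-filter-∪ P? Q? R? xs (R⊆P∪Q ∘ there) | R? x
  ... | no _  = ≤-trans ih (+-mono-≤ (length-filter-∷ P? x xs) (length-filter-∷ Q? x xs))
  ... | yes rx with R⊆P∪Q (here refl) rx
  ...   | inj₁ px = ≤-trans (s≤s ih)
                      (+-mono-≤ (≤-reflexive (cong length (sym (filter-accept P? px)))) (length-filter-∷ Q? x xs))
  ...   | inj₂ qx = ≤-trans (s≤s ih) (≤-trans (≤-reflexive (sym (+-suc _ _)))
                      (+-mono-≤ (length-filter-∷ P? x xs) (≤-reflexive (cong length (sym (filter-accept Q? qx))))))

  length-filter-filter : ∀ {p q} {P : Pred A p} {Q : Pred A q} (P? : Decidable P) (Q? : Decidable Q) →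
    Q ⊆ P → ∀ xs → length (filter Q? (filter P? xs)) ≡ length (filter Q? xs)
  length-filter-filter P? Q? Q⊆P [] = refl
  length-filter-filter P? Q? Q⊆P (x ∷ xs) with P? x
  ... | yes _ with Q? x
  ...   | yes _ = cong suc (length-filter-filter P? Q? Q⊆P xs)
  ...   | no _  = length-filter-filter P? Q? Q⊆P xs
  length-filter-filter P? Q? Q⊆P (x ∷ xs) | no ¬px with Q? x
  ...   | yes qx = contradiction (Q⊆P qx) ¬px
  ...   | no _   = length-filter-filter P? Q? Q⊆P xs

length-allFin : ∀ n → length (allFin n) ≡ n
length-allFin n = length-tabulate {n = n} (λ i → i)

length-filter-map : ∀ {a b p} {A : Set a} {B : Set b} {P : Pred B p} (P? : Decidable P) (f : A → B) xs →
  length (filter P? (map f xs)) ≡ length (filter (P? ∘ f) xs)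
length-filter-map P? f [] = refl
length-filter-map P? f (x ∷ xs) with P? (f x)
... | yes _ = cong suc (length-filter-map P? f xs)
... | no _  = length-filter-map P? f xs

lookup-injective : ∀ {a} {A : Set a} {xs : List A} → Unique xs → ∀ {i j} → lookup xs i ≡ lookup xs j → i ≡ j
lookup-injective {xs = x ∷ xs} (x∉xs ∷ uniq) {fzero}  {fzero}  _ = refl
lookup-injective {xs = x ∷ xs} (x∉xs ∷ uniq) {fzero}  {fsuc j} e = contradiction e (All.lookup x∉xs (∈-lookup j))
lookup-injective {xs = x ∷ xs} (x∉xs ∷ uniq) {fsuc i} {fzero}  e = contradiction (sym e) (All.lookup x∉xs (∈-lookup i))
lookup-injective {xs = x ∷ xs} (x∉xs ∷ uniq) {fsuc i} {fsuc j} e = cong fsuc (lookup-injective uniq e)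

two-distinct : ∀ {a} {A : Set a} {xs : List A} → Unique xs → 2 ≤ length xs →
  ∃ λ x → ∃ λ y → x ∈ xs × y ∈ xs × x ≢ y
two-distinct {xs = x ∷ y ∷ _} ((x≢y ∷ _) ∷ _) _         = x , y , here refl , there (here refl) , x≢y
two-distinct {xs = _ ∷ []}    _                 (s≤s ())

avoid-two : ∀ {a q} {A : Set a} {Q : A → Set q} → DecidableEquality A → ∀ {x y z} → Q x → Q y → Q z →
  x ≢ y → x ≢ z → y ≢ z → ∀ v₁ v₂ → ∃ λ w → Q w × w ≢ v₁ × w ≢ v₂
avoid-two _≟_ {x} {y} {z} qx qy qz x≢y x≢z y≢z v₁ v₂ with classify x | classify y | classify z
  where
  classify : ∀ w → (w ≢ v₁ × w ≢ v₂) ⊎ (w ≡ v₁ ⊎ w ≡ v₂)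
  classify w with w ≟ v₁ | w ≟ v₂
  ... | yes w≡ | _      = inj₂ (inj₁ w≡)
  ... | no _   | yes w≡ = inj₂ (inj₂ w≡)
  ... | no w≢₁ | no w≢₂ = inj₁ (w≢₁ , w≢₂)
... | inj₁ (≢₁ , ≢₂) | _              | _              = x , qx , ≢₁ , ≢₂
... | inj₂ _         | inj₁ (≢₁ , ≢₂) | _              = y , qy , ≢₁ , ≢₂
... | inj₂ _         | inj₂ _         | inj₁ (≢₁ , ≢₂) = z , qz , ≢₁ , ≢₂
... | inj₂ (inj₁ x≡) | inj₂ (inj₁ y≡) | inj₂ _         = contradiction (trans x≡ (sym y≡)) x≢y
... | inj₂ (inj₂ x≡) | inj₂ (inj₂ y≡) | inj₂ _         = contradiction (trans x≡ (sym y≡)) x≢y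
... | inj₂ (inj₁ x≡) | inj₂ (inj₂ _)  | inj₂ (inj₁ z≡) = contradiction (trans x≡ (sym z≡)) x≢z
... | inj₂ (inj₂ x≡) | inj₂ (inj₁ _)  | inj₂ (inj₂ z≡) = contradiction (trans x≡ (sym z≡)) x≢z
... | inj₂ (inj₁ _)  | inj₂ (inj₂ y≡) | inj₂ (inj₂ z≡) = contradiction (trans y≡ (sym z≡)) y≢z
... | inj₂ (inj₂ _)  | inj₂ (inj₁ y≡) | inj₂ (inj₁ z≡) = contradiction (trans y≡ (sym z≡)) y≢z

≤-maxList : ∀ {x xs} → x ∈ xs → x ≤ maxList xs
≤-maxList {xs = y ∷ xs} (here refl) = m≤m⊔n y (maxList xs)
≤-maxList {xs = y ∷ xs} (there x∈) = ≤-trans (≤-maxList x∈) (m≤n⊔m y (maxList xs))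

maxList-least : ∀ {b} xs → (∀ {x} → x ∈ xs → x ≤ b) → maxList xs ≤ b
maxList-least []       _ = z≤n
maxList-least (y ∷ xs) h = ⊔-lub (h (here refl)) (maxList-least xs (h ∘ there))

maxList-∈ : ∀ xs → maxList xs ≡ 0 ⊎ maxList xs ∈ xs
maxList-∈ [] = inj₁ refl
maxList-∈ (y ∷ xs) with ⊔-sel y (maxList xs) | maxList-∈ xs
... | inj₁ e | _      = inj₂ (subst (_∈ y ∷ xs) (sym e) (here refl))
... | inj₂ e | inj₁ z = inj₁ (trans e z)
... | inj₂ e | inj₂ m = inj₂ (subst (_∈ y ∷ xs) (sym e) (there m))

insert-≤ : ∀ {x y} ys → x ≤ y → insert x (y ∷ ys) ≡ x ∷ y ∷ ys
insert-≤ {x} {y} _ x≤y with x ≤ᵇ y | ≤⇒≤ᵇ x≤y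
... | true | _ = refl

insert-> : ∀ {x y} ys → y < x → insert x (y ∷ ys) ≡ y ∷ insert x ys
insert-> {x} {y} _ y<x with x ≤ᵇ y | ≤ᵇ⇒≤ x y
... | false | _    = refl
... | true  | x≤y = contradiction (x≤y _) (<⇒≱ y<x)

sum-take-suc-insert : ∀ x S k → sum (take (suc k) (insert x S)) ≤ x + sum (take k S)
sum-take-suc-insert x []       k = ≤-refl
sum-take-suc-insert x (y ∷ ys) k with x ≤? y
... | yes x≤y rewrite insert-≤ ys x≤y = ≤-refl
... | no x≰y rewrite insert-> ys (≰⇒> x≰y) with k
...   | zero   = +-monoˡ-≤ 0 (<⇒≤ (≰⇒> x≰y))
...   | suc k′ = begin
  y + sum (take (suc k′) (insert x ys)) ≤⟨ +-monoʳ-≤ y (sum-take-suc-insert x ys k′) ⟩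
  y + (x + sum (take k′ ys))           ≡⟨ x∙yz≈y∙xz y x _ ⟩
  x + (y + sum (take k′ ys))           ∎
  where open ≤-Reasoning

+-sum-take-≤ : ∀ {x L k} → All (x ≤_) L → k < length L → x + sum (take k L) ≤ sum (take (suc k) L)
+-sum-take-≤ {x} {y ∷ ys} {zero}  (x≤y ∷ _) _ = +-monoˡ-≤ 0 x≤y
+-sum-take-≤ {x} {y ∷ ys} {suc k} (_ ∷ x≤ys) (s≤s k<ys) = begin
  x + (y + sum (take k ys))  ≡⟨ x∙yz≈y∙xz x y _ ⟩
  y + (x + sum (take k ys))  ≤⟨ +-monoʳ-≤ y (+-sum-take-≤ x≤ys k<ys) ⟩
  y + sum (take (suc k) ys)  ∎
  where open ≤-Reasoning

sum-take-insert : ∀ x {S} k → AllPairs _≤_ S → k ≤ length S → sum (take k (insert x S)) ≤ sum (take k S)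
sum-take-insert x zero _ _ = ≤-refl
sum-take-insert x {y ∷ ys} (suc k) (y≤ys ∷ sorted) (s≤s k≤ys) with x ≤? y
... | yes x≤y rewrite insert-≤ ys x≤y = +-sum-take-≤ (x≤y ∷ All.map (≤-trans x≤y) y≤ys) (s≤s k≤ys)
... | no x≰y rewrite insert-> ys (≰⇒> x≰y) = +-monoʳ-≤ y (sum-take-insert x k sorted k≤ys)

sum-take-sort-≤ : ∀ {a p} {A : Set a} {P : Pred A p} (P? : Decidable P) (g : A → ℕ) xs →
  sum (take (length (filter P? xs)) (sort (map g xs))) ≤ sum (map g (filter P? xs))
sum-take-sort-≤ P? g [] = ≤-refl
sum-take-sort-≤ P? g (x ∷ xs) with P? x
... | yes _ = ≤-trans (sum-take-suc-insert (g x) (sort (map g xs)) _) (+-monoʳ-≤ (g x) (sum-take-sort-≤ P? g xs))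
... | no _  = ≤-trans (sum-take-insert (g x) _ (Linked⇒AllPairs ≤-trans (sort-↗ (map g xs))) k≤)
                      (sum-take-sort-≤ P? g xs)
  where
  k≤ : length (filter P? xs) ≤ length (sort (map g xs))
  k≤ = ≤-trans (length-filter P? xs) (≤-reflexive (sym (trans (↭-length (sort-↭ (map g xs))) (length-map g xs))))

sum-take-mono : ∀ {k l} xs → k ≤ l → sum (take k xs) ≤ sum (take l xs)
sum-take-mono {zero}              _        _         = z≤n
sum-take-mono {suc k} {suc l}     []       _         = ≤-refl
sum-take-mono {suc k} {suc l}     (x ∷ xs) (s≤s k≤l) = +-monoʳ-≤ x (sum-take-mono xs k≤l)

sum-take≤sum-take-length : ∀ k xs → sum (take k xs) ≤ sum (take (length xs) xs)
sum-take≤sum-take-length zero    _        = z≤n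
sum-take≤sum-take-length (suc k) []       = ≤-refl
sum-take≤sum-take-length (suc k) (x ∷ xs) = +-monoʳ-≤ x (sum-take≤sum-take-length k xs)

∸2≤ : ∀ {a b c d} → a ≡ b + c + d → c ≤ 1 → d ≤ 1 → a ∸ 2 ≤ b
∸2≤ {a} {b} {c} {d} refl c≤1 d≤1 = begin
  b + c + d ∸ 2  ≤⟨ ∸-monoˡ-≤ 2 (+-mono-≤ (+-monoʳ-≤ b c≤1) d≤1) ⟩
  b + 1 + 1 ∸ 2  ≡⟨ cong (_∸ 2) (+-assoc b 1 1) ⟩
  b + 2 ∸ 2      ≡⟨ m+n∸n≡m b 2 ⟩
  b              ∎
  where open ≤-Reasoning

-- Reachability outside a vertex

adj⇒≢ : ∀ {n} (G : Graph n) {u v} → adj G u v ≡ true → v ≢ u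
adj⇒≢ G {u} a refl = ≡true⇒≢false a (irrefl G u)

module Reachability {n} (G : Graph n) (z : Fin n) where

  VSet : Set
  VSet = Fin n → Bool

  _⊆ᵛ_ : VSet → VSet → Set
  S ⊆ᵛ S′ = ∀ {v} → S v ≡ true → S′ v ≡ true

  Closed : VSet → Set
  Closed X = ∀ {u v} → X u ≡ true → adj G u v ≡ true → v ≢ z → X v ≡ true

  card : VSet → ℕ
  card S = length (filter (λ v → T? (S v)) (allFin n))

  neqZ-true⁺ : ∀ {v} → v ≢ z → neqZ G z v ≡ true
  neqZ-true⁺ {v} v≢z = not-true⁺ (dec-false⁺ (v ≟ z) v≢z)

  neqZ-true⁻ : ∀ {v} → neqZ G z v ≡ true → v ≢ z
  neqZ-true⁻ {v} e = dec-false⁻ (v ≟ z) (not-true⁻ _ e)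

  step-⊇ : ∀ S → S ⊆ᵛ step G z S
  step-⊇ S {v} = ∨-true⁺ˡ _

  step-edge : ∀ S {u v} → S u ≡ true → adj G u v ≡ true → v ≢ z → step G z S v ≡ true
  step-edge S {u} {v} su a v≢z = ∨-true⁺ʳ (S v) (∧-true⁺ (neqZ-true⁺ v≢z)
    (any-true⁺ (λ w → S w ∧ adj G w v) (∈-allFin u) (∧-true⁺ su a)))

  step-true⁻ : ∀ S {v} → step G z S v ≡ true →
    S v ≡ true ⊎ (v ≢ z × ∃ λ u → S u ≡ true × adj G u v ≡ true)
  step-true⁻ S {v} e with ∨-true⁻ (S v) e
  ... | inj₁ sv = inj₁ sv
  ... | inj₂ e′ with ∧-true⁻ (neqZ G z v) e′
  ...   | v≢z , e″ with any-true⁻ (λ w → S w ∧ adj G w v) (allFin n) e″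
  ...     | u , _ , su∧a = inj₂ (neqZ-true⁻ v≢z , u , ∧-true⁻ (S u) su∧a)

  iter-least : ∀ {X S} → Closed X → S ⊆ᵛ X → ∀ k → iter G z k S ⊆ᵛ X
  iter-least cl S⊆X zero    = S⊆X
  iter-least {S = S} cl S⊆X (suc k) e with step-true⁻ (iter G z k S) e
  ... | inj₁ old                    = iter-least cl S⊆X k old
  ... | inj₂ (v≢z , u , old , u~v) = cl (iter-least cl S⊆X k old) u~v v≢z

  step-closed : ∀ {X} → Closed X → Closed (step G z X)
  step-closed {X} cl su a v≢z = step-⊇ X (cl (iter-least cl (λ e → e) 1 su) a v≢z)

  iter-⊇ : ∀ S k → S ⊆ᵛ iter G z k S
  iter-⊇ S zero    e = e
  iter-⊇ S (suc k) e = step-⊇ (iter G z k S) (iter-⊇ S k e)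

  card-≤ : ∀ S → card S ≤ n
  card-≤ S = ≤-trans (length-filter (λ v → T? (S v)) (allFin n)) (≤-reflexive (length-allFin n))

  step-grows-or-closed : ∀ X → card X < card (step G z X) ⊎ Closed X
  step-grows-or-closed X with any? (λ v → (step G z X v ≟ᵇ true) ×-dec (X v ≟ᵇ false))
  ... | yes (v , new , ¬old) = inj₁ (length-filter-< (λ v → T? (X v)) (λ v → T? (step G z X v))
          (≡true⇒T ∘ step-⊇ X ∘ T⇒≡true) (∈-allFin v) (≡true⇒T new) (λ t → ≡true⇒≢false (T⇒≡true t) ¬old))
  ... | no ¬new = inj₂ closed
    where
    closed : Closed X
    closed {v = v} xu a v≢z with X v in xv
    ... | true  = refl
    ... | false = contradiction (v , step-edge X xu a v≢z , xv) ¬new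

  iter-grows-or-closed : ∀ S → 0 < card S → ∀ k → k < card (iter G z k S) ⊎ Closed (iter G z k S)
  iter-grows-or-closed S ne zero = inj₁ ne
  iter-grows-or-closed S ne (suc k) with iter-grows-or-closed S ne k
  ... | inj₂ cl = inj₂ (step-closed cl)
  ... | inj₁ k<card with step-grows-or-closed (iter G z k S)
  ...   | inj₁ grows = inj₁ (≤-trans (s≤s k<card) grows)
  ...   | inj₂ cl    = inj₂ (step-closed cl)

  iter-closed : ∀ S → 0 < card S → Closed (iter G z n S)
  iter-closed S ne with iter-grows-or-closed S ne n
  ... | inj₁ n<card = contradiction (card-≤ _) (<⇒≱ n<card)
  ... | inj₂ cl     = cl

  reach : Fin n → VSet
  reach u = iter G z n (λ w → ⌊ w ≟ u ⌋)

  reach-closed : ∀ u → Closed (reach u)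
  reach-closed u = iter-closed _
    (filter-some (λ v → T? ⌊ v ≟ u ⌋) (lose (∈-allFin u) (≡true⇒T (dec-true⁺ (u ≟ u) refl))))

  reach-refl : ∀ u → reach u u ≡ true
  reach-refl u = iter-⊇ _ n (dec-true⁺ (u ≟ u) refl)

  reach-trans : ∀ {u v w} → reach u v ≡ true → reach v w ≡ true → reach u w ≡ true
  reach-trans {u} {v} u⇝v = iter-least (reach-closed u) v∈ n
    where
    v∈ : (λ w → ⌊ w ≟ v ⌋) ⊆ᵛ reach u
    v∈ {x} x≡v rewrite dec-true⁻ (x ≟ v) x≡v = u⇝v

  -- The vertices outside z from which u is reachable form a closed set containing u.
  reach-sym : ∀ {u v} → u ≢ z → reach u v ≡ true → reach v u ≡ true
  reach-sym {u} u≢z u⇝v = proj₂ (∧-true⁻ (neqZ G z _) (iter-least closed u∈Y n u⇝v))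
    where
    Y : VSet
    Y w = neqZ G z w ∧ reach w u
    closed : Closed Y
    closed {w} {v} yw w~v v≢z = ∧-true⁺ (neqZ-true⁺ v≢z)
      (reach-trans (reach-closed v (reach-refl v) (trans (Graph.sym G v w) w~v) (neqZ-true⁻ (proj₁ (∧-true⁻ _ yw))))
                   (proj₂ (∧-true⁻ _ yw)))
    u∈Y : (λ w → ⌊ w ≟ u ⌋) ⊆ᵛ Y
    u∈Y {x} e rewrite dec-true⁻ (x ≟ u) e = ∧-true⁺ (neqZ-true⁺ u≢z) (reach-refl u)

-- Local components

module Components {n} (G : Graph n) (z : Fin n) where

  open Reachability G z public

  -- u ~ v : u and v lie in the same local component at z (a record, so that u and v can be inferred).
  record _~_ (u v : Fin n) : Set where
    constructor ⟨_⟩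
    field ~⇒conn : conn G z u v ≡ true
  open _~_ public

  infix 4 _~_ _~?_

  _~?_ : ∀ u v → Dec (u ~ v)
  u ~? v with conn G z u v in e
  ... | true  = yes ⟨ e ⟩
  ... | false = no λ u~v → ≡true⇒≢false (~⇒conn u~v) e

  ~⁺ : ∀ {u v} → u ≢ z → v ≢ z → reach u v ≡ true → u ~ v
  ~⁺ u≢z v≢z u⇝v = ⟨ ∧-true⁺ (neqZ-true⁺ u≢z) (∧-true⁺ (neqZ-true⁺ v≢z) u⇝v) ⟩

  ~-≢ˡ : ∀ {u v} → u ~ v → u ≢ z
  ~-≢ˡ {u} ⟨ e ⟩ = neqZ-true⁻ (proj₁ (∧-true⁻ (neqZ G z u) e))

  ~-≢ʳ : ∀ {u v} → u ~ v → v ≢ z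
  ~-≢ʳ {u} {v} ⟨ e ⟩ = neqZ-true⁻ (proj₁ (∧-true⁻ (neqZ G z v) (proj₂ (∧-true⁻ (neqZ G z u) e))))

  ~-reach : ∀ {u v} → u ~ v → reach u v ≡ true
  ~-reach {u} {v} ⟨ e ⟩ = proj₂ (∧-true⁻ (neqZ G z v) (proj₂ (∧-true⁻ (neqZ G z u) e)))

  ~-refl : ∀ {u} → u ≢ z → u ~ u
  ~-refl {u} u≢z = ~⁺ u≢z u≢z (reach-refl u)

  ~-sym : ∀ {u v} → u ~ v → v ~ u
  ~-sym u~v = ~⁺ (~-≢ʳ u~v) (~-≢ˡ u~v) (reach-sym (~-≢ˡ u~v) (~-reach u~v))

  ~-trans : ∀ {u v w} → u ~ v → v ~ w → u ~ w
  ~-trans u~v v~w = ~⁺ (~-≢ˡ u~v) (~-≢ʳ v~w) (reach-trans (~-reach u~v) (~-reach v~w))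

  ~-edge : ∀ {u x y} → u ~ x → adj G x y ≡ true → y ≢ z → u ~ y
  ~-edge {u} u~x a y≢z = ~⁺ (~-≢ˡ u~x) y≢z (reach-closed u (~-reach u~x) a y≢z)

  adj⇒~ : ∀ {x y} → x ≢ z → y ≢ z → adj G x y ≡ true → x ~ y
  adj⇒~ x≢z y≢z a = ~-edge (~-refl x≢z) a y≢z

  ∈-comp⁺ : ∀ {u v} → u ~ v → v ∈ comp G z u
  ∈-comp⁺ {u} {v} u~v = ∈-filter⁺ (λ w → T? (conn G z u w)) (∈-allFin v) (≡true⇒T (~⇒conn u~v))

  ∈-comp⁻ : ∀ {u v} → v ∈ comp G z u → u ~ v
  ∈-comp⁻ {u} v∈ = ⟨ T⇒≡true (proj₂ (∈-filter⁻ (λ w → T? (conn G z u w)) {xs = allFin n} v∈)) ⟩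

  isRep-≢ : ∀ {u} → isRep G z u ≡ true → u ≢ z
  isRep-≢ {u} e = neqZ-true⁻ (proj₁ (∧-true⁻ (neqZ G z u) e))

  isRep-least : ∀ {u v} → isRep G z u ≡ true → u ~ v → toℕ u ≤ toℕ v
  isRep-least {u} {v} e u~v =
    dec-true⁻ (toℕ u ≤? toℕ v)
              (all-true⁻ (λ w → ⌊ toℕ u ≤? toℕ w ⌋) (proj₂ (∧-true⁻ (neqZ G z u) e)) (∈-comp⁺ u~v))

  isRep-unique : ∀ {u u′ w} → isRep G z u ≡ true → isRep G z u′ ≡ true → u ~ w → u′ ~ w → u ≡ u′
  isRep-unique r r′ u~w u′~w = toℕ-injective (≤-antisym
    (isRep-least r  (~-trans u~w  (~-sym u′~w)))
    (isRep-least r′ (~-trans u′~w (~-sym u~w))))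

  ∈-reps⁻ : ∀ {u} → u ∈ reps G z → isRep G z u ≡ true
  ∈-reps⁻ u∈ = T⇒≡true (proj₂ (∈-filter⁻ (λ u → T? (isRep G z u)) {xs = allFin n} u∈))

  reps-unique : Unique (reps G z)
  reps-unique = Unique.filter⁺ (λ u → T? (isRep G z u)) (Unique.allFin⁺ n)

  nonExterior⇒adj : ∀ {u v} → isExterior G z u ≡ false → u ~ v → adj G z v ≡ true
  nonExterior⇒adj {u} {v} e u~v with adj G z v in zv
  ... | true  = refl
  ... | false = contradiction e
                  (≡true⇒≢false (any-true⁺ (λ w → not (adj G z w)) (∈-comp⁺ u~v) (not-true⁺ zv)))

  exterior⇒nonadj : ∀ {u} → isExterior G z u ≡ true → ∃ λ v → u ~ v × adj G z v ≡ false
  exterior⇒nonadj {u} e with any-true⁻ (λ w → not (adj G z w)) (comp G z u) e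
  ... | v , v∈ , nz = v , ∈-comp⁻ v∈ , not-true⁻ _ nz

  ⋃comp : List (Fin n) → VSet
  ⋃comp Rs w = any (λ u → conn G z u w) Rs

  ∈-⋃comp⁺ : ∀ {Rs u w} → u ∈ Rs → u ~ w → ⋃comp Rs w ≡ true
  ∈-⋃comp⁺ {w = w} u∈ u~w = any-true⁺ (λ u → conn G z u w) u∈ (~⇒conn u~w)

  ∈-⋃comp⁻ : ∀ {Rs w} → ⋃comp Rs w ≡ true → ∃ λ u → u ∈ Rs × u ~ w
  ∈-⋃comp⁻ {Rs} {w} e = let u , u∈ , u-w = any-true⁻ (λ u → conn G z u w) Rs e in u , u∈ , ⟨ u-w ⟩

  card-⋃comp : ∀ Rs → Unique Rs → (∀ {u} → u ∈ Rs → isRep G z u ≡ true) →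
    card (⋃comp Rs) ≡ sum (map (length ∘ comp G z) Rs)
  card-⋃comp []       _              _    = cong length (filter-none _ (All.universal (λ _ ()) (allFin n)))
  card-⋃comp (u ∷ Rs) (u∉Rs ∷ uniq) reps = trans
    (length-filter-⊎ (λ w → T? (conn G z u w)) (λ w → T? (⋃comp Rs w)) (λ w → T? (⋃comp (u ∷ Rs) w))
      (Equivalence.to T-∨) (Equivalence.from T-∨ ∘ inj₁) (Equivalence.from T-∨ ∘ inj₂) disjoint (allFin n))
    (cong (length (comp G z u) +_) (card-⋃comp Rs uniq (reps ∘ there)))
    where
    disjoint : ∀ {w} → T (conn G z u w) → T (⋃comp Rs w) → ⊥
    disjoint t t′ with u′ , u′∈ , u′~w ← ∈-⋃comp⁻ {Rs} (T⇒≡true t′) =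
      All.lookup u∉Rs u′∈ (isRep-unique (reps (here refl)) (reps (there u′∈)) ⟨ T⇒≡true t ⟩ u′~w)

  nonExteriorReps : List (Fin n)
  nonExteriorReps = filter (λ u → T? (not (isExterior G z u))) (reps G z)

  exteriorReps : List (Fin n)
  exteriorReps = filter (λ u → T? (isExterior G z u)) (reps G z)

  ∈-nonExteriorReps⁻ : ∀ {u} → u ∈ nonExteriorReps → isRep G z u ≡ true × isExterior G z u ≡ false
  ∈-nonExteriorReps⁻ u∈ = let u∈reps , ne = ∈-filter⁻ (λ u → T? (not (isExterior G z u))) u∈
                          in ∈-reps⁻ u∈reps , not-true⁻ _ (T⇒≡true ne)

  ∈-exteriorReps⁻ : ∀ {u} → u ∈ exteriorReps → isRep G z u ≡ true × isExterior G z u ≡ true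
  ∈-exteriorReps⁻ u∈ = let u∈reps , e = ∈-filter⁻ (λ u → T? (isExterior G z u)) u∈
                       in ∈-reps⁻ u∈reps , T⇒≡true e

  nonExteriorReps-unique : Unique nonExteriorReps
  nonExteriorReps-unique = Unique.filter⁺ (λ u → T? (not (isExterior G z u))) reps-unique

  exteriorReps-unique : Unique exteriorReps
  exteriorReps-unique = Unique.filter⁺ (λ u → T? (isExterior G z u)) reps-unique

  numComps≡ : numComps G z ≡ length nonExteriorReps + length exteriorReps
  numComps≡ = sym (length-filter-partition (λ u → T? (not (isExterior G z u))) (λ u → T? (isExterior G z u))
    cover (λ t t′ → ≡true⇒≢false (T⇒≡true t′) (not-true⁻ _ (T⇒≡true t))) (reps G z))
    where
    cover : ∀ u → T (not (isExterior G z u)) ⊎ T (isExterior G z u)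
    cover u with isExterior G z u
    ... | true  = inj₂ _
    ... | false = inj₁ _

  -- In every representation the interval of x₁ contains an endpoint of the interval of z.
  record Anchor (u : Fin n) : Set where
    field
      {x₁ x₂} : Fin n
      u~x₁    : u ~ x₁
      u~x₂    : u ~ x₂
      z-x₁    : adj G z x₁ ≡ true
      x₁-x₂   : adj G x₁ x₂ ≡ true
      z-x₂    : adj G z x₂ ≡ false

restrict : ∀ {n m} {G : Graph n} → Representation G → (f : Fin m → Fin n) → Injective _≡_ _≡_ f →
  Representation (induced G f)
restrict α f f-inj = record
  { I       = I α ∘ f
  ; correct = λ i j i≢j → correct α (f i) (f j) (i≢j ∘ f-inj) }

module InducedOn {n} (P : Fin n → Bool) where

  elems : List (Fin n)
  elems = filter (λ v → T? (P v)) (allFin n)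

  m : ℕ
  m = length elems

  f : Fin m → Fin n
  f = lookup elems

  f-∈ : ∀ i → P (f i) ≡ true
  f-∈ i = T⇒≡true (proj₂ (∈-filter⁻ (λ v → T? (P v)) {xs = allFin n} (∈-lookup i)))

  f-injective : Injective _≡_ _≡_ f
  f-injective = lookup-injective (Unique.filter⁺ (λ v → T? (P v)) (Unique.allFin⁺ n))

  f-onto : ∀ {v} → P v ≡ true → ∃ λ i → f i ≡ v
  f-onto {v} e = index v∈ , sym (lookup-index v∈)
    where v∈ = ∈-filter⁺ (λ v → T? (P v)) (∈-allFin v) (≡true⇒T e)

  m<n : ∀ {w} → P w ≡ false → m < n
  m<n {w} e = ≤-trans
    (filter-notAll (λ v → T? (P v)) (allFin n) (lose (∈-allFin w) (λ t → ≡true⇒≢false (T⇒≡true t) e)))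
    (≤-reflexive (length-allFin n))

  length-filter-f : ∀ {q} {Q : Pred (Fin n) q} (Q? : Decidable Q) → (∀ {v} → Q v → P v ≡ true) →
    length (filter Q? (allFin n)) ≡ length (filter (Q? ∘ f) (allFin m))
  length-filter-f Q? Q⊆P = begin
    length (filter Q? (allFin n))          ≡⟨ length-filter-filter (λ v → T? (P v)) Q? (≡true⇒T ∘ Q⊆P) (allFin n) ⟨
    length (filter Q? elems)               ≡⟨ cong (length ∘ filter Q?) map-f ⟨
    length (filter Q? (map f (allFin m)))  ≡⟨ length-filter-map Q? f (allFin m) ⟩
    length (filter (Q? ∘ f) (allFin m))    ∎
    where
    open ≡-Reasoning
    map-f : map f (allFin m) ≡ elems
    map-f = trans (map-tabulate (λ i → i) f) (tabulate-lookup elems)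

  impAt-f-≤ : ∀ {G : Graph n} (γ : Representation G) {G′ : Graph m} (β : Representation G′) i →
    (∀ {w} → w ≢ f i → I γ w ⊆ᴵ I γ (f i) → P w ≡ true) →
    (∀ {j} → I γ (f j) ⊆ᴵ I γ (f i) → I β j ⊆ᴵ I β i) →
    impAt γ (f i) ≤ impAt β i
  impAt-f-≤ γ β i inP reflect = begin
    impAt γ (f i)                        ≡⟨ length-filter-f Q? (λ (w≢ , w⊆) → inP w≢ w⊆) ⟩
    length (filter (Q? ∘ f) (allFin m))  ≤⟨ length-filter-mono (Q? ∘ f) _ (λ (≢ , ⊆) → ≢ ∘ cong f , reflect ⊆) (allFin m) ⟩
    impAt β i                            ∎
    where
    open ≤-Reasoning
    Q? : Decidable (λ w → w ≢ f i × I γ w ⊆ᴵ I γ (f i))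
    Q? w = ¬? (w ≟ f i) ×-dec (I γ w ⊆ᴵ? I γ (f i))

-- Critical graphs

least-¬¬ : ∀ {p} {P : ℕ → Set p} k → P k → ¬ ¬ ∃ λ q → P q × (∀ {q′} → q′ < q → ¬ P q′)
least-¬¬ {P = P} = <-rec (λ k → P k → ¬ ¬ ∃ λ q → P q × (∀ {q′} → q′ < q → ¬ P q′))
  (λ k rec pk ¬least → ¬least (k , pk , λ {q′} q′<k pq′ → rec q′<k pq′ ¬least))

-- imp(H) is a minimum over all representations of H, which exists only classically: hence the double negation.
critical-small-rep-¬¬ : ∀ {n m} {G : Graph n} {p} {f : Fin m → Fin n} →
  Critical G p → Injective _≡_ _≡_ f → m < n →
  ¬ ¬ Σ (Representation (induced G f)) (λ β → impRep β < p)
critical-small-rep-¬¬ {m = m} {G} {p} {f} (_ , ((α , _) , _) , proper) f-inj m<n ¬small =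
  least-¬¬ {P = λ q → Σ (Representation (induced G f)) (λ β → impRep β ≡ q)} (impRep β₀) (β₀ , refl)
    λ (q , (β , β≡q) , least) → ¬small (β , subst (_< p) (sym β≡q)
      (proper m f f-inj m<n q ((β , β≡q) , λ β′ → ≮⇒≥ (λ β′<q → least β′<q (β′ , refl)))))
  where
  β₀ : Representation (induced G f)
  β₀ = restrict α f f-inj

critical-¬all-rep≥ : ∀ {n m} {G : Graph n} {p} {f : Fin m → Fin n} →
  Critical G p → Injective _≡_ _≡_ f → m < n →
  ¬ (∀ β → p ≤ impRep {G = induced G f} β)
critical-¬all-rep≥ crit f-inj m<n all≥ =
  critical-small-rep-¬¬ crit f-inj m<n λ (β , β<p) → <⇒≱ β<p (all≥ β)

module Juxtapose {n} (G : Graph n) (S : Fin n → Bool)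
  (S-closed : ∀ {x y} → S x ≡ true → adj G x y ≡ true → S y ≡ true) where

  module L = InducedOn S
  module R = InducedOn (not ∘ S)

  R∉S : ∀ j → S (R.f j) ≡ false
  R∉S j = not-true⁻ _ (R.f-∈ j)

  L≢R : ∀ i j → L.f i ≢ R.f j
  L≢R i j e = ≡true⇒≢false (L.f-∈ i) (subst (λ v → S v ≡ false) (sym e) (R∉S j))

  data Side (v : Fin n) : Set where
    left  : ∀ i → L.f i ≡ v → Side v
    right : ∀ j → R.f j ≡ v → Side v

  side : ∀ v → Side v
  side v with S v in e
  ... | true  = let i , fi≡v = L.f-onto e in left i fi≡v
  ... | false = let j , fj≡v = R.f-onto (not-true⁺ e) in right j fj≡v

  module _ (β₁ : Representation (induced G L.f)) (β₂ : Representation (induced G R.f)) where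

    M : ℕ
    M = suc (maxList (map (hi ∘ I β₂) (allFin R.m)))

    shift : Interval → Interval
    shift [ a , b ∣ a≤b ] = [ a + M , b + M ∣ +-monoˡ-≤ M a≤b ]

    R<L : ∀ j A → hi (I β₂ j) < lo (shift A)
    R<L j [ a , _ ∣ _ ] = ≤-trans (s≤s (≤-maxList (∈-map⁺ (hi ∘ I β₂) (∈-allFin j)))) (m≤n+m M a)

    shift-Meets : ∀ A B → Meets A B ⇔ Meets (shift A) (shift B)
    shift-Meets [ a , b ∣ _ ] [ a′ , b′ ∣ _ ] = mk⇔
      (λ (a≤b′ , a′≤b) → +-monoˡ-≤ M a≤b′ , +-monoˡ-≤ M a′≤b)
      (λ (a≤b′ , a′≤b) → +-cancelʳ-≤ M a b′ a≤b′ , +-cancelʳ-≤ M a′ b a′≤b)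

    shift-⊆ᴵ : ∀ A B → shift A ⊆ᴵ shift B → A ⊆ᴵ B
    shift-⊆ᴵ [ a , b ∣ _ ] [ a′ , b′ ∣ _ ] (a′≤a , b≤b′) =
      +-cancelʳ-≤ M a′ a a′≤a , +-cancelʳ-≤ M b b′ b≤b′

    J : ∀ {v} → Side v → Interval
    J (left i _)  = shift (I β₁ i)
    J (right j _) = I β₂ j

    γI : Fin n → Interval
    γI v = J (side v)

    γI-side : ∀ {v} (s : Side v) → γI v ≡ J s
    γI-side {v} s with side v | s
    ... | left i e  | left i′ e′  = cong (shift ∘ I β₁) (L.f-injective (trans e (sym e′)))
    ... | right j e | right j′ e′ = cong (I β₂) (R.f-injective (trans e (sym e′)))
    ... | left i e  | right j e′  = contradiction (trans e (sym e′)) (L≢R i j)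
    ... | right j e | left i e′   = contradiction (trans e′ (sym e)) (L≢R i j)

    J-correct : ∀ {v w} (s : Side v) (t : Side w) → v ≢ w → (adj G v w ≡ true ⇔ Meets (J s) (J t))
    J-correct (left i refl) (left i′ refl) v≢w = let e = correct β₁ i i′ (v≢w ∘ cong L.f) in mk⇔
      (Equivalence.to (shift-Meets (I β₁ i) (I β₁ i′)) ∘ Equivalence.to e)
      (Equivalence.from e ∘ Equivalence.from (shift-Meets (I β₁ i) (I β₁ i′)))
    J-correct (right j refl) (right j′ refl) v≢w = correct β₂ j j′ (v≢w ∘ cong R.f)
    J-correct (left i refl) (right j refl) _ = mk⇔
      (λ a → ⊥-elim (≡true⇒≢false (S-closed (L.f-∈ i) a) (R∉S j)))
      (λ (lo≤hi , _) → ⊥-elim (<⇒≱ (R<L j (I β₁ i)) lo≤hi))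
    J-correct (right j refl) (left i refl) _ = mk⇔
      (λ a → ⊥-elim (≡true⇒≢false (S-closed (L.f-∈ i) (trans (Graph.sym G (L.f i) (R.f j)) a)) (R∉S j)))
      (λ (_ , lo≤hi) → ⊥-elim (<⇒≱ (R<L j (I β₁ i)) lo≤hi))

    γ : Representation G
    γ = record { I = γI ; correct = λ v w → J-correct (side v) (side w) }

    impAt-left : ∀ i → impAt γ (L.f i) ≤ impAt β₁ i
    impAt-left i = L.impAt-f-≤ γ β₁ i inS reflect
      where
      inS : ∀ {w} → w ≢ L.f i → γI w ⊆ᴵ γI (L.f i) → S w ≡ true
      inS {w} _ w⊆ with side w | γI-side (side w)
      ... | left i′ refl | _  = L.f-∈ i′
      ... | right j refl | eq = contradiction (subst₂ _⊆ᴵ_ eq (γI-side (left i refl)) w⊆) λ (lo≤lo , _) →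
                                  <⇒≱ (R<L j (I β₁ i)) (≤-trans lo≤lo (lo≤hi (I β₂ j)))
      reflect : ∀ {j} → γI (L.f j) ⊆ᴵ γI (L.f i) → I β₁ j ⊆ᴵ I β₁ i
      reflect {j} = shift-⊆ᴵ (I β₁ j) (I β₁ i) ∘ subst₂ _⊆ᴵ_ (γI-side (left j refl)) (γI-side (left i refl))

    impAt-right : ∀ j → impAt γ (R.f j) ≤ impAt β₂ j
    impAt-right j = R.impAt-f-≤ γ β₂ j inR reflect
      where
      inR : ∀ {w} → w ≢ R.f j → γI w ⊆ᴵ γI (R.f j) → not (S w) ≡ true
      inR {w} _ w⊆ with side w | γI-side (side w)
      ... | right j′ refl | _  = R.f-∈ j′
      ... | left i refl   | eq = contradiction (subst₂ _⊆ᴵ_ eq (γI-side (right j refl)) w⊆) λ (_ , hi≤hi) →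
                                   <⇒≱ (R<L j (I β₁ i)) (≤-trans (lo≤hi (shift (I β₁ i))) hi≤hi)
      reflect : ∀ {j′} → γI (R.f j′) ⊆ᴵ γI (R.f j) → I β₂ j′ ⊆ᴵ I β₂ j
      reflect {j′} = subst₂ _⊆ᴵ_ (γI-side (right j′ refl)) (γI-side (right j refl))

    impRep-γ : impRep γ ≤ impRep β₁ ⊔ impRep β₂
    impRep-γ = maxList-least (map (impAt γ) (allFin n)) λ mem →
      let v , _ , e = ∈-map⁻ (impAt γ) mem in subst (_≤ impRep β₁ ⊔ impRep β₂) (sym e) (bound (side v))
      where
      bound : ∀ {v} → Side v → impAt γ v ≤ impRep β₁ ⊔ impRep β₂
      bound (left i refl)  =
        ≤-trans (impAt-left i)  (≤-trans (≤-maxList (∈-map⁺ (impAt β₁) (∈-allFin i))) (m≤m⊔n _ _))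
      bound (right j refl) =
        ≤-trans (impAt-right j) (≤-trans (≤-maxList (∈-map⁺ (impAt β₂) (∈-allFin j))) (m≤n⊔m _ _))

critical-no-cut : ∀ {n} {G : Graph n} {p} → Critical G p → (S : Fin n → Bool) →
  (∀ {x y} → S x ≡ true → adj G x y ≡ true → S y ≡ true) → ∀ {s t} → S s ≡ true → S t ≡ false → ⊥
critical-no-cut {G = G} crit@(_ , (_ , minimal) , _) S S-closed s∈S t∉S =
  critical-small-rep-¬¬ crit L.f-injective (L.m<n t∉S) λ (β₁ , β₁<p) →
  critical-small-rep-¬¬ crit R.f-injective (R.m<n (not-false⁺ s∈S)) λ (β₂ , β₂<p) →
  <⇒≱ (⊔-lub β₁<p β₂<p) (≤-trans (minimal (γ β₁ β₂)) (impRep-γ β₁ β₂))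
  where open Juxtapose G S S-closed

module LocalStructure {n} {G : Graph n} {p} (crit : Critical G p) (c : Fin n) where
  open Components G c

  critical-neighbour : ∀ {u} → u ≢ c → ∃ λ v → u ~ v × adj G c v ≡ true
  critical-neighbour {u} u≢c with any? (λ v → (u ~? v) ×-dec (adj G c v ≟ᵇ true))
  ... | yes found = found
  ... | no ¬found = ⊥-elim (critical-no-cut crit S S-closed
                      (dec-true⁺ (u ~? u) (~-refl u≢c)) (dec-false⁺ (u ~? c) λ u~c → ~-≢ʳ u~c refl))
    where
    S : Fin n → Bool
    S v = ⌊ u ~? v ⌋
    S-closed : ∀ {x y} → S x ≡ true → adj G x y ≡ true → S y ≡ true
    S-closed {x} {y} x∈S x-y = dec-true⁺ (u ~? y) (~-edge u~x x-y y≢c)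
      where
      u~x : u ~ x
      u~x = dec-true⁻ (u ~? x) x∈S
      y≢c : y ≢ c
      y≢c refl = ¬found (x , u~x , trans (Graph.sym G c x) x-y)

  -- If there were no anchor, the neighbours of c reachable from a would form a closed set.
  anchor : ∀ {u w} → u ~ w → adj G c w ≡ false → Anchor u
  anchor {u} {w} u~w c-w with critical-neighbour (~-≢ˡ u~w)
  ... | a , u~a , c-a with any? (λ x₁ → any? (λ x₂ →
        (a ~? x₁) ×-dec (a ~? x₂) ×-dec (adj G c x₁ ≟ᵇ true) ×-dec (adj G x₁ x₂ ≟ᵇ true) ×-dec (adj G c x₂ ≟ᵇ false)))
  ...   | yes (x₁ , x₂ , a~x₁ , a~x₂ , c-x₁ , x₁-x₂ , c-x₂) =
          record { u~x₁ = ~-trans u~a a~x₁ ; u~x₂ = ~-trans u~a a~x₂ ; z-x₁ = c-x₁ ; x₁-x₂ = x₁-x₂ ; z-x₂ = c-x₂ }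
  ...   | no ¬anchor = ⊥-elim (≡true⇒≢false (proj₂ (∧-true⁻ (reach a w) w∈Y)) c-w)
    where
    a≢c : a ≢ c
    a≢c = ~-≢ʳ u~a
    Y : VSet
    Y v = reach a v ∧ adj G c v
    a∈Y : (λ v → ⌊ v ≟ a ⌋) ⊆ᵛ Y
    a∈Y {v} e rewrite dec-true⁻ (v ≟ a) e = ∧-true⁺ (reach-refl a) c-a
    Y-closed : Closed Y
    Y-closed {x} {y} x∈Y x-y y≢c with ∧-true⁻ (reach a x) x∈Y
    ... | a⇝x , c-x with adj G c y in c-y
    ...   | true  = ∧-true⁺ (reach-closed a a⇝x x-y y≢c) refl
    ...   | false = contradiction
      (x , y , ~⁺ a≢c (adj⇒≢ G c-x) a⇝x , ~⁺ a≢c y≢c (reach-closed a a⇝x x-y y≢c) , c-x , x-y , c-y) ¬anchor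
    w∈Y : Y w ≡ true
    w∈Y = iter-least Y-closed a∈Y n (~-reach (~-trans (~-sym u~a) u~w))

data End : Set where
  left right : End

endpoint : End → Interval → ℕ
endpoint left  C = lo C
endpoint right C = hi C

_∋ᴵ_ : Interval → ℕ → Set
J ∋ᴵ t = lo J ≤ t × t ≤ hi J

_∋ᴵ?_ : ∀ J t → Dec (J ∋ᴵ t)
J ∋ᴵ? t = (lo J ≤? t) ×-dec (t ≤? hi J)

∋ᴵ⇒Meets : ∀ J J′ {t} → J ∋ᴵ t → J′ ∋ᴵ t → Meets J J′
∋ᴵ⇒Meets _ _ (lo≤t , t≤hi) (lo′≤t , t≤hi′) = ≤-trans lo≤t t≤hi′ , ≤-trans lo′≤t t≤hi

Meets-⊈ᴵ⇒∋ᴵ-end : ∀ C J → Meets C J → ¬ J ⊆ᴵ C → ∃ λ e → J ∋ᴵ endpoint e C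
Meets-⊈ᴵ⇒∋ᴵ-end C J (loC≤hiJ , loJ≤hiC) J⊈C with lo C ≤? lo J | hi J ≤? hi C
... | no loC≰loJ  | _         = left , <⇒≤ (≰⇒> loC≰loJ) , loC≤hiJ
... | yes loC≤loJ | yes hiJ≤hiC = contradiction (loC≤loJ , hiJ≤hiC) J⊈C
... | yes _       | no hiJ≰hiC = right , loJ≤hiC , <⇒≤ (≰⇒> hiJ≰hiC)

Meets-¬Meets⇒∋ᴵ-end : ∀ C J J′ → Meets C J → Meets J J′ → ¬ Meets C J′ → ∃ λ e → J ∋ᴵ endpoint e C
Meets-¬Meets⇒∋ᴵ-end C J J′ (loC≤hiJ , loJ≤hiC) (loJ≤hiJ′ , loJ′≤hiJ) C∩J′=∅ with lo J′ ≤? hi C | lo C ≤? hi J′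
... | no loJ′≰hiC | _           = right , loJ≤hiC , ≤-trans (<⇒≤ (≰⇒> loJ′≰hiC)) loJ′≤hiJ
... | yes loJ′≤hiC | yes loC≤hiJ′ = contradiction (loC≤hiJ′ , loJ′≤hiC) C∩J′=∅
... | yes _       | no loC≰hiJ′ = left , ≤-trans loJ≤hiJ′ (<⇒≤ (≰⇒> loC≰hiJ′)) , loC≤hiJ

module AtBasepoint {n} (G : Graph n) (c : Fin n) (P : Fin n → Bool) (c∈P : P c ≡ true)
  (β : Representation (induced G (InducedOn.f P))) where

  open InducedOn P
  open Components G c

  i₀ : Fin m
  i₀ = proj₁ (f-onto c∈P)

  fi₀≡c : f i₀ ≡ c
  fi₀≡c = proj₂ (f-onto c∈P)

  K : Fin m → Interval
  K = I β

  Meets⇒adj : ∀ {j j′} → j ≢ j′ → Meets (K j) (K j′) → adj G (f j) (f j′) ≡ true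
  Meets⇒adj {j} {j′} j≢j′ = Equivalence.from (correct β j j′ j≢j′)

  adj⇒Meets : ∀ {j j′} → adj G (f j) (f j′) ≡ true → Meets (K j) (K j′)
  adj⇒Meets {j} {j′} a = Equivalence.to (correct β j j′ λ { refl → ≡true⇒≢false a (irrefl G (f j)) }) a

  c-adj⇒Meets : ∀ {j} → adj G c (f j) ≡ true → Meets (K i₀) (K j)
  c-adj⇒Meets {j} a = adj⇒Meets {i₀} {j} (subst (λ v → adj G v (f j) ≡ true) (sym fi₀≡c) a)

  c-nonadj⇒¬Meets : ∀ {j} → f j ≢ c → adj G c (f j) ≡ false → ¬ Meets (K i₀) (K j)
  c-nonadj⇒¬Meets {j} fj≢c na mt = ≡true⇒≢false
    (subst (λ v → adj G v (f j) ≡ true) fi₀≡c (Meets⇒adj {i₀} {j} (λ { refl → fj≢c fi₀≡c }) mt)) na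

  Covers : End → Fin m → Set
  Covers e j = K j ∋ᴵ endpoint e (K i₀)

  anchor-covers : ∀ {j₁ j₂} → adj G c (f j₁) ≡ true → adj G (f j₁) (f j₂) ≡ true → adj G c (f j₂) ≡ false →
    f j₂ ≢ c → ∃ λ e → Covers e j₁
  anchor-covers {j₁} {j₂} c-x₁ x₁-x₂ c-x₂ x₂≢c =
    Meets-¬Meets⇒∋ᴵ-end (K i₀) (K j₁) (K j₂)
      (c-adj⇒Meets {j₁} c-x₁) (adj⇒Meets {j₁} {j₂} x₁-x₂) (c-nonadj⇒¬Meets {j₂} x₂≢c c-x₂)

  ~-common-point : ∀ {u j j′ t} → u ~ f j → f j′ ≢ c → K j ∋ᴵ t → K j′ ∋ᴵ t → u ~ f j′
  ~-common-point {j = j} {j′} u~fj fj′≢c t∈ t∈′ with j ≟ j′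
  ... | yes refl = u~fj
  ... | no j≢j′  = ~-edge u~fj (Meets⇒adj {j} {j′} j≢j′ (∋ᴵ⇒Meets (K j) (K j′) t∈ t∈′)) fj′≢c

  NR : List (Fin n)
  NR = nonExteriorReps

  Inside : Fin n → Set
  Inside u = ∀ j → u ~ f j → K j ⊆ᴵ K i₀

  Inside? : Decidable Inside
  Inside? u = all? (λ j → (u ~? f j) →-dec (K j ⊆ᴵ? K i₀))

  Sticks : End → Fin n → Set
  Sticks e u = ∃ λ j → u ~ f j × Covers e j

  Sticks? : ∀ e → Decidable (Sticks e)
  Sticks? e u = any? (λ j → (u ~? f j) ×-dec (K j ∋ᴵ? endpoint e (K i₀)))

  -- Every vertex of a non-exterior component meets the interval of c.
  ¬Inside⇒Sticks : ∀ {u} → u ∈ NR → ¬ Inside u → Sticks left u ⊎ Sticks right u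
  ¬Inside⇒Sticks {u} u∈ ¬inside
    with j , ¬inj ← ¬∀⟶∃¬ m _ (λ j → (u ~? f j) →-dec (K j ⊆ᴵ? K i₀)) ¬inside | u ~? f j
  ... | no ¬u~fj = contradiction (λ u~fj → contradiction u~fj ¬u~fj) ¬inj
  ... | yes u~fj
    with Meets-⊈ᴵ⇒∋ᴵ-end (K i₀) (K j) (c-adj⇒Meets {j} (nonExterior⇒adj (proj₂ (∈-nonExteriorReps⁻ u∈)) u~fj))
                                       (¬inj ∘ λ j⊆ _ → j⊆)
  ...   | left  , cov = inj₁ (j , u~fj , cov)
  ...   | right , cov = inj₂ (j , u~fj , cov)

  Sticks-unique : ∀ e {u u′} → u ∈ NR → u′ ∈ NR → u ≢ u′ → Sticks e u → Sticks e u′ → ⊥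
  Sticks-unique e u∈ u′∈ u≢u′ (j , u~fj , cov) (j′ , u′~fj′ , cov′) =
    u≢u′ (isRep-unique (proj₁ (∈-nonExteriorReps⁻ u∈)) (proj₁ (∈-nonExteriorReps⁻ u′∈))
                       (~-common-point u~fj (~-≢ʳ u′~fj′) cov cov′) u′~fj′)

  record Blocked (r : Fin n) (e : End) : Set where
    constructor blocked
    field
      {j}     : Fin m
      r~fj    : r ~ f j
      covers  : Covers e j
      outside : ∀ {u} → u ∈ NR → ¬ u ~ f j

  Blocked⇒¬Sticks : ∀ {r e u} → Blocked r e → u ∈ NR → ¬ Sticks e u
  Blocked⇒¬Sticks (blocked r~fj′ cov′ outside) u∈ (j , u~fj , cov) = outside u∈ (~-common-point u~fj (~-≢ʳ r~fj′) cov cov′)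

  Blocked-same-end : ∀ {r r′ e} → Blocked r e → Blocked r′ e → r ~ r′
  Blocked-same-end (blocked r~fj cov _) (blocked r′~fj′ cov′ _) =
    ~-trans (~-common-point r~fj (~-≢ʳ r′~fj′) cov cov′) (~-sym r′~fj′)

  #sticking : End → ℕ
  #sticking e = length (filter (Sticks? e) NR)

  #sticking≤1 : ∀ e → #sticking e ≤ 1
  #sticking≤1 e = length-filter-≤1 (Sticks? e) nonExteriorReps-unique (λ u∈ u′∈ → Sticks-unique e u∈ u′∈)

  #sticking-blocked : ∀ {r e} → Blocked r e → #sticking e ≡ 0
  #sticking-blocked {e = e} b = cong length (filter-none (Sticks? e) (All.tabulate (Blocked⇒¬Sticks b)))

  #inside #outside : ℕ
  #inside  = length (filter Inside? NR)
  #outside = length (filter (¬? ∘ Inside?) NR)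

  #outside≤ : #outside ≤ #sticking left + #sticking right
  #outside≤ = length-filter-∪ (Sticks? left) (Sticks? right) (¬? ∘ Inside?) NR ¬Inside⇒Sticks

  #inside+#outside : #inside + #outside ≡ length NR
  #inside+#outside = length-filter-partition Inside? (¬? ∘ Inside?) (λ u → toSum (Inside? u)) (λ i ¬i → ¬i i) NR

  order : Fin n → ℕ
  order u = length (comp G c u)

  sum-inside≤impAt : (∀ {u v} → u ∈ NR → u ~ v → P v ≡ true) → sum (map order (filter Inside? NR)) ≤ impAt β i₀
  sum-inside≤impAt NR⊆P = begin
    sum (map order RS)                    ≡⟨ card-⋃comp RS (Unique.filter⁺ Inside? nonExteriorReps-unique) RS-reps ⟨
    card (⋃comp RS)                       ≡⟨ length-filter-f (λ w → T? (⋃comp RS w)) in-P ⟩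
    length (filter (Q? ∘ f) (allFin m))   ≤⟨ length-filter-mono (Q? ∘ f) _ inside-c (allFin m) ⟩
    impAt β i₀                            ∎
    where
    open ≤-Reasoning
    RS : List (Fin n)
    RS = filter Inside? NR
    ∈-RS⁻ : ∀ {u} → u ∈ RS → u ∈ NR × Inside u
    ∈-RS⁻ = ∈-filter⁻ Inside? {xs = NR}
    RS-reps : ∀ {u} → u ∈ RS → isRep G c u ≡ true
    RS-reps = proj₁ ∘ ∈-nonExteriorReps⁻ ∘ proj₁ ∘ ∈-RS⁻
    Q? : Decidable (λ w → T (⋃comp RS w))
    Q? w = T? (⋃comp RS w)
    in-P : ∀ {w} → T (⋃comp RS w) → P w ≡ true
    in-P t = let _ , u∈ , u~w = ∈-⋃comp⁻ {RS} (T⇒≡true t) in NR⊆P (proj₁ (∈-RS⁻ u∈)) u~w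
    inside-c : ∀ {j} → T (⋃comp RS (f j)) → j ≢ i₀ × K j ⊆ᴵ K i₀
    inside-c {j} t with _ , u∈ , u~fj ← ∈-⋃comp⁻ {RS} (T⇒≡true t) =
      (λ { refl → ~-≢ʳ u~fj fi₀≡c }) , proj₂ (∈-RS⁻ u∈) j u~fj

  sum-take≤impRep : (∀ {u v} → u ∈ NR → u ~ v → P v ≡ true) → ∀ {k} → k ≤ #inside →
    sum (take k (sort (nonExtOrders G c))) ≤ impRep β
  sum-take≤impRep NR⊆P {k} k≤ = begin
    sum (take k (sort (map order NR)))         ≤⟨ sum-take-mono (sort (map order NR)) k≤ ⟩
    sum (take #inside (sort (map order NR)))   ≤⟨ sum-take-sort-≤ Inside? order NR ⟩
    sum (map order (filter Inside? NR))        ≤⟨ sum-inside≤impAt NR⊆P ⟩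
    impAt β i₀                                ≤⟨ ≤-maxList (∈-map⁺ (impAt β) (∈-allFin i₀)) ⟩
    impRep β                                  ∎
    where open ≤-Reasoning

  Anchor⇒Blocked : ∀ {r} (A : Anchor r) → P (Anchor.x₁ A) ≡ true → P (Anchor.x₂ A) ≡ true →
    (∀ {u} → u ∈ NR → ¬ u ~ Anchor.x₁ A) → ∃ (Blocked r)
  Anchor⇒Blocked A x₁∈P x₂∈P outside
    with j₁ , refl ← f-onto x₁∈P | j₂ , refl ← f-onto x₂∈P
    with e , cov ← anchor-covers {j₁} {j₂} (Anchor.z-x₁ A) (Anchor.x₁-x₂ A) (Anchor.z-x₂ A) (~-≢ʳ (Anchor.u~x₂ A))
    = e , blocked (Anchor.u~x₁ A) cov outside

  #outside≤1 : ∀ {r} → ∃ (Blocked r) → #outside ≤ 1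
  #outside≤1 (left , b) = begin
    #outside                           ≤⟨ #outside≤ ⟩
    #sticking left + #sticking right   ≡⟨ cong (_+ #sticking right) (#sticking-blocked b) ⟩
    #sticking right                    ≤⟨ #sticking≤1 right ⟩
    1                                  ∎
    where open ≤-Reasoning
  #outside≤1 (right , b) = begin
    #outside                           ≤⟨ #outside≤ ⟩
    #sticking left + #sticking right   ≡⟨ cong (#sticking left +_) (#sticking-blocked b) ⟩
    #sticking left + 0                 ≡⟨ +-identityʳ _ ⟩
    #sticking left                     ≤⟨ #sticking≤1 left ⟩
    1                                  ∎
    where open ≤-Reasoning

  #outside≡0 : ∀ {r r′} → Blocked r left → Blocked r′ right → #outside ≡ 0
  #outside≡0 bl br =
    n≤0⇒n≡0 (≤-trans #outside≤ (≤-reflexive (cong₂ _+_ (#sticking-blocked bl) (#sticking-blocked br))))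

-- At most one vertex of positive weight

wt-pos⇒3≤numComps : ∀ {n} (G : Graph n) x → 0 < wt G x → 3 ≤ numComps G x
wt-pos⇒3≤numComps G x pos with 3 ≤? numComps G x
... | yes 3≤ = 3≤
... | no 3≰ = contradiction
  (subst (λ k → 0 < sum (take k (sort (nonExtOrders G x)))) (m≤n⇒m∸n≡0 (≤-pred (≰⇒> 3≰))) pos) λ ()

module _ {n} (G : Graph n) (x : Fin n) where
  open Components G x

  -- At most one local component at x contains c.
  2≤#avoiding : ∀ c → 0 < wt G x → 2 ≤ length (filter (¬? ∘ (_~? c)) (reps G x))
  2≤#avoiding c pos = +-cancelˡ-≤ 1 2 _ (begin
    3                                                  ≤⟨ wt-pos⇒3≤numComps G x pos ⟩
    numComps G x                                       ≡⟨ length-filter-partition (_~? c) (¬? ∘ (_~? c))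
                                                            (λ r → toSum (r ~? c)) (λ r~c r≁c → r≁c r~c) (reps G x) ⟨
    length (filter (_~? c) (reps G x)) + length (filter (¬? ∘ (_~? c)) (reps G x))
                                                       ≤⟨ +-monoˡ-≤ _ #with-c≤1 ⟩
    1 + length (filter (¬? ∘ (_~? c)) (reps G x))      ∎)
    where
    open ≤-Reasoning
    #with-c≤1 : length (filter (_~? c) (reps G x)) ≤ 1
    #with-c≤1 = length-filter-≤1 (_~? c) reps-unique λ r∈ r′∈ r≢r′ r~c r′~c →
      r≢r′ (isRep-unique (∈-reps⁻ r∈) (∈-reps⁻ r′∈) r~c r′~c)

  two-components-avoiding : ∀ c → 0 < wt G x →
    ∃ λ r → ∃ λ r′ → isRep G x r ≡ true × isRep G x r′ ≡ true × r ≢ r′ × ¬ r ~ c × ¬ r′ ~ c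
  two-components-avoiding c pos
    with r , r′ , r∈ , r′∈ , r≢r′ ← two-distinct (Unique.filter⁺ (¬? ∘ (_~? c)) reps-unique) (2≤#avoiding c pos)
    = let r∈reps , r≁c = ∈-filter⁻ (¬? ∘ (_~? c)) r∈ ; r′∈reps , r′≁c = ∈-filter⁻ (¬? ∘ (_~? c)) r′∈
      in r , r′ , ∈-reps⁻ r∈reps , ∈-reps⁻ r′∈reps , r≢r′ , r≁c , r′≁c

module TwoBasepoints {n} {G : Graph n} {p} (crit : Critical G p) {c x : Fin n} (x≢c : x ≢ c)
  (wt-c : wt G c ≡ p) (wt-x : 0 < wt G x) where

  open Components G c
  open LocalStructure crit c
  module X = Components G x
  module LX = LocalStructure crit x
  open import Data.List.Membership.DecPropositional (_≟_ {n}) using (_∈?_)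

  NR ER : List (Fin n)
  NR = nonExteriorReps
  ER = exteriorReps

  ¬~ˣc⇒far : ∀ {r w} → r X.~ w → ¬ r X.~ c → w ≢ c × adj G c w ≡ false
  ¬~ˣc⇒far {r} {w} r~w r≁c = w≢c , c-w
    where
    w≢c : w ≢ c
    w≢c refl = r≁c r~w
    c-w : adj G c w ≡ false
    c-w with adj G c w in e
    ... | false = refl
    ... | true  = contradiction (X.~-trans r~w (X.adj⇒~ (X.~-≢ʳ r~w) (x≢c ∘ sym) (trans (Graph.sym G w c) e))) r≁c

  far-neighbour : ∀ {r} → isRep G x r ≡ true → ¬ r X.~ c → ∃ λ w → r X.~ w × x ~ w × adj G c w ≡ false
  far-neighbour r-rep r≁c =
    let w , r~w , x-w = LX.critical-neighbour (X.isRep-≢ r-rep) ; w≢c , c-w = ¬~ˣc⇒far r~w r≁c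
    in w , r~w , adj⇒~ x≢c w≢c x-w , c-w

  -- The proper induced subgraph used against criticality: c, the non-exterior components and the
  -- edges of two anchors, but not w₃.  Every representation of it has impropriety at least p.
  module Omitting {w₃} (x~w₃ : x ~ w₃) {r r′} (A : Anchor r) (B : Anchor r′)
    (w₃∉ : ¬ w₃ ∈ Anchor.x₁ A ∷ Anchor.x₂ A ∷ Anchor.x₁ B ∷ Anchor.x₂ B ∷ [])
    (w₃-outside : ∀ {u} → u ∈ NR → ¬ u ~ w₃)
    (A-outside : ∀ {u} → u ∈ NR → ¬ u ~ Anchor.x₁ A) (B-outside : ∀ {u} → u ∈ NR → ¬ u ~ Anchor.x₁ B) where

    extras : List (Fin n)
    extras = c ∷ Anchor.x₁ A ∷ Anchor.x₂ A ∷ Anchor.x₁ B ∷ Anchor.x₂ B ∷ []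

    inH : Fin n → Bool
    inH v = ⌊ v ∈? extras ⌋ ∨ ⋃comp NR v

    module H = InducedOn inH

    extra∈H : ∀ {v} → v ∈ extras → inH v ≡ true
    extra∈H {v} v∈ = ∨-true⁺ˡ _ (dec-true⁺ (v ∈? extras) v∈)

    NR⊆H : ∀ {u v} → u ∈ NR → u ~ v → inH v ≡ true
    NR⊆H {v = v} u∈ u~v = ∨-true⁺ʳ ⌊ v ∈? extras ⌋ (∈-⋃comp⁺ u∈ u~v)

    w₃∉extras : ¬ w₃ ∈ extras
    w₃∉extras (here w₃≡c) = ~-≢ʳ x~w₃ w₃≡c
    w₃∉extras (there w₃∈) = w₃∉ w₃∈

    w₃∉H : inH w₃ ≡ false
    w₃∉H with inH w₃ in e
    ... | false = refl
    ... | true with ∨-true⁻ ⌊ w₃ ∈? extras ⌋ e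
    ...   | inj₁ e′ = ⊥-elim (w₃∉extras (dec-true⁻ (w₃ ∈? extras) e′))
    ...   | inj₂ e′ = let _ , u∈ , u~w₃ = ∈-⋃comp⁻ {NR} e′ in ⊥-elim (w₃-outside u∈ u~w₃)

    ¬all-rep≥p : (∀ β → p ≤ impRep {G = induced G H.f} β) → ⊥
    ¬all-rep≥p = critical-¬all-rep≥ crit H.f-injective (H.m<n w₃∉H)

    module Geometry (β : Representation (induced G H.f)) where
      open AtBasepoint G c inH (extra∈H (here refl)) β public hiding (NR)

      A-blocks : ∃ (Blocked r)
      A-blocks = Anchor⇒Blocked A (extra∈H (there (here refl))) (extra∈H (there (there (here refl)))) A-outside

      B-blocks : ∃ (Blocked r′)
      B-blocks = Anchor⇒Blocked B (extra∈H (there (there (there (here refl)))))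
                                  (extra∈H (there (there (there (there (here refl)))))) B-outside

      p≤impRep-few : numComps G c ∸ 2 ≤ #inside → p ≤ impRep β
      p≤impRep-few k≤ = subst (_≤ impRep β) wt-c (sum-take≤impRep NR⊆H k≤)

      p≤impRep-all : #outside ≡ 0 → p ≤ impRep β
      p≤impRep-all none = begin
        p                                     ≡⟨ wt-c ⟨
        wt G c                                ≤⟨ sum-take≤sum-take-length (numComps G c ∸ 2) S ⟩
        sum (take (length S) S)               ≤⟨ sum-take≤impRep NR⊆H (≤-reflexive length-S) ⟩
        impRep β                              ∎
        where
        open ≤-Reasoning
        S : List ℕ
        S = sort (nonExtOrders G c)
        length-S : length S ≡ #inside
        length-S = begin-equality
          length S                  ≡⟨ ↭-length (sort-↭ (nonExtOrders G c)) ⟩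
          length (nonExtOrders G c) ≡⟨ length-map order NR ⟩
          length NR                 ≡⟨ #inside+#outside ⟨
          #inside + #outside        ≡⟨ cong (#inside +_) none ⟩
          #inside + 0               ≡⟨ +-identityʳ #inside ⟩
          #inside                   ∎

  module Core {wa wb} (x~wa : x ~ wa) (c-wa : adj G c wa ≡ false) (x~wb : x ~ wb)
    (x≢wa : x ≢ wa) (x≢wb : x ≢ wb) (wa≢wb : wa ≢ wb) where

    A : Anchor x
    A = anchor x~wa c-wa

    NR-avoids-x : ∀ {u y} → u ∈ NR → x ~ y → ¬ u ~ y
    NR-avoids-x u∈ x~y u~y =
      ≡true⇒≢false (nonExterior⇒adj (proj₂ (∈-nonExteriorReps⁻ u∈)) (~-trans u~y (~-trans (~-sym x~y) x~wa))) c-wa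

    A-outside : ∀ {u} → u ∈ NR → ¬ u ~ Anchor.x₁ A
    A-outside u∈ = NR-avoids-x u∈ (Anchor.u~x₁ A)

    module WithOmitted {w₃} (x~w₃ : x ~ w₃) (w₃≢a₁ : w₃ ≢ Anchor.x₁ A) (w₃≢a₂ : w₃ ≢ Anchor.x₂ A) where

      w₃-outside : ∀ {u} → u ∈ NR → ¬ u ~ w₃
      w₃-outside u∈ = NR-avoids-x u∈ x~w₃

      w₃∉AA : ¬ w₃ ∈ Anchor.x₁ A ∷ Anchor.x₂ A ∷ Anchor.x₁ A ∷ Anchor.x₂ A ∷ []
      w₃∉AA (here e)                         = w₃≢a₁ e
      w₃∉AA (there (here e))                 = w₃≢a₂ e
      w₃∉AA (there (there (here e)))         = w₃≢a₁ e
      w₃∉AA (there (there (there (here e)))) = w₃≢a₂ e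

      few-exterior : length ER ≤ 1 → ⊥
      few-exterior ER≤1 = ¬all-rep≥p λ β → let open Geometry β in
        p≤impRep-few (∸2≤ (begin-equality
          numComps G c                   ≡⟨ numComps≡ ⟩
          length NR + length ER          ≡⟨ cong (_+ length ER) #inside+#outside ⟨
          #inside + #outside + length ER ∎) (#outside≤1 A-blocks) ER≤1)
        where
        open ≤-Reasoning
        open Omitting x~w₃ A A w₃∉AA w₃-outside A-outside A-outside

      -- A second exterior component yields a second anchor, covering the other end of c's interval.
      module Far {e} (e∈ : e ∈ ER) (e≁x : ¬ e ~ x) where

        B : Anchor e
        B = let _ , e~v , c-v = exterior⇒nonadj (proj₂ (∈-exteriorReps⁻ e∈)) in anchor e~v c-v

        x≁ : ∀ {y} → e ~ y → ¬ x ~ y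
        x≁ e~y x~y = e≁x (~-trans e~y (~-sym x~y))

        w₃∉AB : ¬ w₃ ∈ Anchor.x₁ A ∷ Anchor.x₂ A ∷ Anchor.x₁ B ∷ Anchor.x₂ B ∷ []
        w₃∉AB (here e)                         = w₃≢a₁ e
        w₃∉AB (there (here e))                 = w₃≢a₂ e
        w₃∉AB (there (there (here e)))         = x≁ (Anchor.u~x₁ B) (subst (x ~_) e x~w₃)
        w₃∉AB (there (there (there (here e)))) = x≁ (Anchor.u~x₂ B) (subst (x ~_) e x~w₃)

        B-outside : ∀ {u} → u ∈ NR → ¬ u ~ Anchor.x₁ B
        B-outside {u} u∈ u~b₁ =
          ≡true⇒≢false (subst (λ v → isExterior G c v ≡ true) (sym u≡e) (proj₂ (∈-exteriorReps⁻ e∈)))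
                       (proj₂ (∈-nonExteriorReps⁻ u∈))
          where
          u≡e : u ≡ e
          u≡e = isRep-unique (proj₁ (∈-nonExteriorReps⁻ u∈)) (proj₁ (∈-exteriorReps⁻ e∈)) u~b₁ (Anchor.u~x₁ B)

        absurd : ⊥
        absurd = ¬all-rep≥p λ β → let open Geometry β in p≤impRep-all (both-ends β A-blocks B-blocks)
          where
          open Omitting x~w₃ A B w₃∉AB w₃-outside A-outside B-outside
          both-ends : ∀ β → ∃ (Geometry.Blocked β x) → ∃ (Geometry.Blocked β e) → Geometry.#outside β ≡ 0
          both-ends β (left  , bA) (right , bB) = Geometry.#outside≡0 β bA bB
          both-ends β (right , bA) (left  , bB) = Geometry.#outside≡0 β bB bA
          both-ends β (left  , bA) (left  , bB) = ⊥-elim (e≁x (~-sym (Geometry.Blocked-same-end β bA bB)))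
          both-ends β (right , bA) (right , bB) = ⊥-elim (e≁x (~-sym (Geometry.Blocked-same-end β bA bB)))

      many-exterior : 2 ≤ length ER → ⊥
      many-exterior 2≤ with e₁ , e₂ , e₁∈ , e₂∈ , e₁≢e₂ ← two-distinct exteriorReps-unique 2≤ | e₁ ~? x | e₂ ~? x
      ... | no e₁≁x | _ = Far.absurd e₁∈ e₁≁x
      ... | yes _ | no e₂≁x = Far.absurd e₂∈ e₂≁x
      ... | yes e₁~x | yes e₂~x =
        e₁≢e₂ (isRep-unique (proj₁ (∈-exteriorReps⁻ e₁∈)) (proj₁ (∈-exteriorReps⁻ e₂∈)) e₁~x e₂~x)

      absurd : ⊥
      absurd with length ER ≤? 1
      ... | yes ER≤1 = few-exterior ER≤1
      ... | no ER≰1  = many-exterior (≰⇒> ER≰1)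

    absurd : ⊥
    absurd = let w₃ , x~w₃ , w₃≢a₁ , w₃≢a₂ = avoid-two {Q = x ~_} _≟_ (~-refl x≢c) x~wa x~wb x≢wa x≢wb wa≢wb _ _
             in WithOmitted.absurd x~w₃ w₃≢a₁ w₃≢a₂

  absurd : ⊥
  absurd
    with ra , rb , ra-rep , rb-rep , ra≢rb , ra≁c , rb≁c ← two-components-avoiding G x c wt-x
    with wa , ra~wa , x~wa , c-wa ← far-neighbour ra-rep ra≁c
       | wb , rb~wb , x~wb , _    ← far-neighbour rb-rep rb≁c
    = Core.absurd x~wa c-wa x~wb (X.~-≢ʳ ra~wa ∘ sym) (X.~-≢ʳ rb~wb ∘ sym) λ wa≡wb →
        ra≢rb (X.isRep-unique ra-rep rb-rep ra~wa (subst (rb X.~_) (sym wa≡wb) rb~wb))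

critical-positive-weight-unique : ∀ {n} {G : Graph n} {p} → Critical G p → ∀ {c x} → wt G c ≡ p → 0 < wt G x → x ≡ c
critical-positive-weight-unique crit {c} {x} wt-c wt-x with x ≟ c
... | yes x≡c = x≡c
... | no x≢c  = ⊥-elim (TwoBasepoints.absurd crit x≢c wt-c wt-x)

Imp-unique : ∀ {n} {G : Graph n} {p q} → Imp G p → Imp G q → p ≡ q
Imp-unique ((α , α≡p) , p-min) ((β , β≡q) , q-min) =
  ≤-antisym (≤-trans (p-min β) (≤-reflexive β≡q)) (≤-trans (q-min α) (≤-reflexive α≡p))

wtG-attained : ∀ {n} (G : Graph n) → 0 < wtG G → ∃ λ z → wt G z ≡ wtG G
wtG-attained G pos with maxList-∈ (map (wt G) (allFin _))
... | inj₁ wtG≡0 = contradiction (subst (0 <_) wtG≡0 pos) λ ()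
... | inj₂ wtG∈ = let z , _ , e = ∈-map⁻ (wt G) wtG∈ in z , sym e

basepoint-exists : ∀ {n} {G : Graph n} {p} → Critical G p → Balanced G → ∃ λ z → wt G z ≡ p
basepoint-exists {G = G} {p} (0<p , imp , _) (_ , imp′ , wtG≡q) =
  let z , wt-z = wtG-attained G (subst (0 <_) (sym wtG≡p) 0<p) in z , trans wt-z wtG≡p
  where
  wtG≡p : wtG G ≡ p
  wtG≡p = trans wtG≡q (Imp-unique imp′ imp)

theorem3p2 : ∀ (n : ℕ) (G : Graph n) (p : ℕ) →
    Critical G p → Balanced G →
    Σ (Fin n) (λ z → IsBasepoint G p z × (∀ (z′ : Fin n) → IsBasepoint G p z′ → z′ ≡ z))
theorem3p2 n G p crit bal with z , wt-z ← basepoint-exists crit bal =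
  z , wt-z , λ z′ wt-z′ → critical-positive-weight-unique crit wt-z (subst (0 <_) (sym wt-z′) (proj₁ crit))
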